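{- If $G$ is a $sat(n, K_{2,3})$-graph with minimum degree $\delta(G) = 1$, then $e(G) \geq 2n - 3$.
   Context: All graphs are finite and simple. A graph is $K_{2,3}$-saturated if it contains no subgraph isomorphic to $K_{2,3}$, but adding any edge between two nonadjacent vertices creates a subgraph isomorphic to $K_{2,3}$. $sat(n,K_{2,3})$ is the minimum number of edges of a $K_{2,3}$-saturated graph on $n$ vertices, and a $sat(n,K_{2,3})$-graph is a $K_{2,3}$-saturated graph on $n$ vertices with exactly $sat(n,K_{2,3})$ edges. $e(G)$ is the number of edges of $G$ and $\delta(G)$ its minimum degree. -}

module Defs where

open import Data.Nat using (ℕ; _+_; _*_; _∸_; _≤_)
open import Data.Bool using (Bool; true; false; if_then_else_; _∨_; _∧_)
open import Data.Fin using (Fin; _<?_) renaming (zero to f0; suc to fs)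
open import Data.Fin.Properties using (_≟_)
open import Data.List using (List; map; allFin)
open import Data.Nat.ListAction using (sum)
open import Data.Product using (Σ; _×_; _,_; ∃)
open import Relation.Nullary using (¬_; does)
open import Relation.Binary.PropositionalEquality using (_≡_)
open import Function.Definitions using (Injective)

record Graph (n : ℕ) : Set where
  field
    adj   : Fin n → Fin n → Bool
    sym   : ∀ u v → adj u v ≡ adj v u
    irrefl : ∀ v → adj v v ≡ false
open Graph public

count : {n : ℕ} → (Fin n → Bool) → ℕ
count {n} p = sum (map (λ i → if p i then 1 else 0) (allFin n))

e : {n : ℕ} → Graph n → ℕ
e G = sum (map (λ u → count (λ v → does (u <? v) ∧ adj G u v)) (allFin _))

deg : {n : ℕ} → Graph n → Fin n → ℕ
deg G v = count (adj G v)

MinDegree : {n : ℕ} → Graph n → ℕ → Set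
MinDegree G d = (Σ _ λ v → deg G v ≡ d) × (∀ v → d ≤ deg G v)

-- vertices of K_{2,3}: 0,1 form the part of size 2, and 2,3,4 the part of size 3
zero' one two three four : Fin 5
zero' = f0
one = fs f0
two = fs (fs f0)
three = fs (fs (fs f0))
four = fs (fs (fs (fs f0)))

ContainsK23 : {n : ℕ} → (Fin n → Fin n → Bool) → Set
ContainsK23 {n} A =
  Σ (Fin 5 → Fin n) λ f → Injective _≡_ _≡_ f ×
    (A (f zero') (f two) ≡ true × A (f zero') (f three) ≡ true × A (f zero') (f four) ≡ true ×
     A (f one) (f two) ≡ true × A (f one) (f three) ≡ true × A (f one) (f four) ≡ true)

addEdge : {n : ℕ} → Graph n → Fin n → Fin n → (Fin n → Fin n → Bool)
addEdge G u v x y =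
  adj G x y ∨ (does (x ≟ u) ∧ does (y ≟ v)) ∨ (does (x ≟ v) ∧ does (y ≟ u))

K23Saturated : {n : ℕ} → Graph n → Set
K23Saturated G =
  ¬ ContainsK23 (adj G) ×
  (∀ u v → ¬ (u ≡ v) → adj G u v ≡ false → ContainsK23 (addEdge G u v))

SatK23Graph : {n : ℕ} → Graph n → Set
SatK23Graph {n} G = K23Saturated G × (∀ (H : Graph n) → K23Saturated H → e G ≤ e H)

-- Let v be a vertex of degree one and w its neighbour. For u ∉ {v, w}, the K₂,₃ created by adding
-- the edge vu must contain v; having only the neighbours w and u there, v lies in the part of size
-- three and {w, u} is the part of size two, so u and w have two common neighbours, both in
-- B = {w} ∪ N(w) ∖ {v}. Now let every edge hand out 2 units: an edge at w to its other end, an edge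
-- inside B ∖ {w} one unit to each end, an edge from outside B into B to its outer end. Then v
-- receives 2 and every u ∉ {v, w} receives at least 4, whence 2 + 4(n − 2) ≤ 2 e(G).
module Submission where

open import Defs renaming (sym to adj-sym)
open import Data.Bool using (Bool; true; false; if_then_else_; not; _∨_; _∧_)
open import Data.Bool.Properties using (¬-not; ∧-identityʳ) renaming (_≟_ to _≟ᵇ_)
open import Data.Empty using (⊥; ⊥-elim)
open import Data.Fin using (Fin; zero; suc; _<?_; punchIn; punchOut)
open import Data.Fin.Properties
  using (_≟_; <-cmp; any?; punchIn-punchOut; punchOut-injective; punchIn-injective; punchInᵢ≢i)
open import Data.List using (map; tabulate; allFin)
open import Data.List.Properties using (map-tabulate)
open import Data.Nat using (ℕ; zero; suc; _+_; _*_; _∸_; _≤_; z≤n)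
open import Data.Nat.ListAction using () renaming (sum to sumˡ)
open import Data.Nat.Properties
  using (+-0-commutativeMonoid; ≤-refl; +-mono-≤; +-monoʳ-≤; +-assoc; +-identityʳ; m≤m+n; *-cancelˡ-≤; *-distribˡ-+; 0≢1+n; 1+n≰n; module ≤-Reasoning)
open import Algebra.Properties.CommutativeMonoid.Sum +-0-commutativeMonoid
  using (sum; sum-cong-≗; sum-remove; sum-replicate-zero; ∑-distrib-+; ∑-comm)
open import Data.Nat.Tactic.RingSolver using (solve-∀)
open import Data.Product using (∃; ∃₂; _×_; _,_; proj₁; swap)
open import Data.Sum using (_⊎_; inj₁; inj₂)
open import Function using (_∘_; id)
open import Function.Definitions using (Injective)
open import Relation.Binary using (tri<; tri≈; tri>)
open import Relation.Binary.PropositionalEquality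
open import Relation.Nullary using (¬_; does; yes; no)
open import Relation.Nullary.Decidable using (dec-true; dec-false)

𝟙 : Bool → ℕ
𝟙 b = if b then 1 else 0

∑∑ : ∀ {n} → (Fin n → Fin n → ℕ) → ℕ
∑∑ f = sum (λ u → sum (f u))

∑-mono-≤ : ∀ {n} {f g : Fin n → ℕ} → (∀ i → f i ≤ g i) → sum f ≤ sum g
∑-mono-≤ {zero}  _   = z≤n
∑-mono-≤ {suc n} f≤g = +-mono-≤ (f≤g zero) (∑-mono-≤ (f≤g ∘ suc))

*≤∑ : ∀ {n k} {f : Fin n → ℕ} → (∀ i → k ≤ f i) → n * k ≤ sum f
*≤∑ {zero}  _   = z≤n
*≤∑ {suc n} k≤f = +-mono-≤ (k≤f zero) (*≤∑ (k≤f ∘ suc))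

∑-pick₁ : ∀ {n} (f : Fin n → ℕ) i → f i ≤ sum f
∑-pick₁ {suc n} f i = begin
  f i                         ≤⟨ m≤m+n (f i) _ ⟩
  f i + sum (f ∘ punchIn i)   ≡⟨ sum-remove f ⟨
  sum f                       ∎
  where open ≤-Reasoning

∑-pick₂ : ∀ {n} (f : Fin n → ℕ) {i j} → i ≢ j → f i + f j ≤ sum f
∑-pick₂ {suc n} f {i} {j} i≢j = begin
  f i + f j                            ≡⟨ cong (λ k → f i + f k) (punchIn-punchOut i≢j) ⟨
  f i + f (punchIn i (punchOut i≢j))   ≤⟨ +-monoʳ-≤ (f i) (∑-pick₁ (f ∘ punchIn i) (punchOut i≢j)) ⟩
  f i + sum (f ∘ punchIn i)            ≡⟨ sum-remove f ⟨
  sum f                                ∎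
  where open ≤-Reasoning

∑-pick₃ : ∀ {n} (f : Fin n → ℕ) {i j k} → i ≢ j → i ≢ k → j ≢ k → f i + (f j + f k) ≤ sum f
∑-pick₃ {suc n} f {i} {j} {k} i≢j i≢k j≢k = begin
  f i + (f j + f k)
    ≡⟨ cong₂ (λ a b → f i + (f a + f b)) (punchIn-punchOut i≢j) (punchIn-punchOut i≢k) ⟨
  f i + (f (punchIn i j′) + f (punchIn i k′))
    ≤⟨ +-monoʳ-≤ (f i) (∑-pick₂ (f ∘ punchIn i) (j≢k ∘ punchOut-injective i≢j i≢k)) ⟩
  f i + sum (f ∘ punchIn i)
    ≡⟨ sum-remove f ⟨
  sum f ∎
  where
  open ≤-Reasoning
  j′ = punchOut i≢j
  k′ = punchOut i≢k

∑-except₂ : ∀ {m k₁ k₂ k} (f : Fin (suc (suc m)) → ℕ) {a b} → a ≢ b →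
  k₁ ≤ f a → k₂ ≤ f b → (∀ u → u ≢ a → u ≢ b → k ≤ f u) → k₁ + k₂ + m * k ≤ sum f
∑-except₂ {m} {k₁} {k₂} {k} f {a} {b} a≢b k₁≤fa k₂≤fb k≤f = begin
  k₁ + k₂ + m * k
    ≤⟨ +-mono-≤ (+-mono-≤ k₁≤fa k₂≤fb) (*≤∑ k≤rest) ⟩
  f a + f b + sum (f ∘ punchIn a ∘ punchIn b′)
    ≡⟨ +-assoc (f a) (f b) _ ⟩
  f a + (f b + sum (f ∘ punchIn a ∘ punchIn b′))
    ≡⟨ cong (λ c → f a + (f c + sum (f ∘ punchIn a ∘ punchIn b′))) (punchIn-punchOut a≢b) ⟨
  f a + (f (punchIn a b′) + sum (f ∘ punchIn a ∘ punchIn b′))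
    ≡⟨ cong (f a +_) (sum-remove (f ∘ punchIn a)) ⟨
  f a + sum (f ∘ punchIn a)
    ≡⟨ sum-remove f ⟨
  sum f ∎
  where
  open ≤-Reasoning
  b′ = punchOut a≢b
  k≤rest : ∀ i → k ≤ f (punchIn a (punchIn b′ i))
  k≤rest i = k≤f _ (punchInᵢ≢i a _) λ eq →
    punchInᵢ≢i b′ i (punchIn-injective a _ _ (trans eq (sym (punchIn-punchOut a≢b))))

∑-𝟙≡1⇒∃! : ∀ {n} (p : Fin n → Bool) → sum (𝟙 ∘ p) ≡ 1 →
  ∃ λ w → p w ≡ true × ∀ t → p t ≡ true → t ≡ w
∑-𝟙≡1⇒∃! {n} p ∑≡1 with any? (λ i → p i ≟ᵇ true)
... | no ∄ = ⊥-elim (0≢1+n (trans (sym ∑≡0) ∑≡1))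
  where
  ∑≡0 : sum (𝟙 ∘ p) ≡ 0
  ∑≡0 = trans (sum-cong-≗ (λ i → cong 𝟙 (¬-not (λ pi → ∄ (i , pi))))) (sum-replicate-zero n)
... | yes (w , pw) = w , pw , unique
  where
  unique : ∀ t → p t ≡ true → t ≡ w
  unique t pt with t ≟ w
  ... | yes t≡w = t≡w
  ... | no t≢w = ⊥-elim (1+n≰n (begin
    2                     ≡⟨ cong₂ (λ a b → 𝟙 a + 𝟙 b) pt pw ⟨
    𝟙 (p t) + 𝟙 (p w)     ≤⟨ ∑-pick₂ (𝟙 ∘ p) t≢w ⟩
    sum (𝟙 ∘ p)           ≡⟨ ∑≡1 ⟩
    1                     ∎))
    where open ≤-Reasoning

∑∑-symmetrise : ∀ {n} (f : Fin n → Fin n → ℕ) → ∑∑ (λ u t → f u t + f t u) ≡ 2 * ∑∑ f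
∑∑-symmetrise f = begin
  ∑∑ (λ u t → f u t + f t u)                  ≡⟨ sum-cong-≗ (λ u → ∑-distrib-+ (f u) (λ t → f t u)) ⟩
  sum (λ u → sum (f u) + sum (λ t → f t u))   ≡⟨ ∑-distrib-+ (λ u → sum (f u)) _ ⟩
  ∑∑ f + sum (λ u → sum (λ t → f t u))        ≡⟨ cong (∑∑ f +_) (∑-comm f) ⟨
  ∑∑ f + ∑∑ f                                 ≡⟨ cong (∑∑ f +_) (+-identityʳ (∑∑ f)) ⟨
  2 * ∑∑ f                                    ∎
  where open ≡-Reasoning

∑∑-mono-symmetrised : ∀ {n} (f g : Fin n → Fin n → ℕ) →
  (∀ u t → f u t + f t u ≤ g u t + g t u) → ∑∑ f ≤ ∑∑ g
∑∑-mono-symmetrised f g f≤g = *-cancelˡ-≤ 2 (begin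
  2 * ∑∑ f                     ≡⟨ ∑∑-symmetrise f ⟨
  ∑∑ (λ u t → f u t + f t u)   ≤⟨ ∑-mono-≤ (λ u → ∑-mono-≤ (f≤g u)) ⟩
  ∑∑ (λ u t → g u t + g t u)   ≡⟨ ∑∑-symmetrise g ⟩
  2 * ∑∑ g                     ∎)
  where open ≤-Reasoning

sumˡ-map-allFin : ∀ {n} (f : Fin n → ℕ) → sumˡ (map f (allFin n)) ≡ sum f
sumˡ-map-allFin f = trans (cong sumˡ (map-tabulate id f)) (sumˡ-tabulate f)
  where
  sumˡ-tabulate : ∀ {n} (g : Fin n → ℕ) → sumˡ (tabulate g) ≡ sum g
  sumˡ-tabulate {zero}  g = refl
  sumˡ-tabulate {suc n} g = cong (g zero +_) (sumˡ-tabulate (g ∘ suc))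

count≡∑𝟙 : ∀ {n} (p : Fin n → Bool) → count p ≡ sum (𝟙 ∘ p)
count≡∑𝟙 p = sumˡ-map-allFin (𝟙 ∘ p)

module _ {n} (G : Graph n) where

  edge< : Fin n → Fin n → ℕ
  edge< u t = 𝟙 (does (u <? t) ∧ adj G u t)

  adj⇒≢ : ∀ {a c} → adj G a c ≡ true → a ≢ c
  adj⇒≢ {a} a∼c refl with () ← trans (sym a∼c) (irrefl G a)

  e≡∑∑edge< : e G ≡ ∑∑ edge<
  e≡∑∑edge< = trans (sumˡ-map-allFin (λ u → count (out u))) (sum-cong-≗ (count≡∑𝟙 ∘ out))
    where
    out : Fin n → Fin n → Bool
    out u t = does (u <? t) ∧ adj G u t

  𝟙adj≡edge<+edge< : ∀ u t → 𝟙 (adj G u t) ≡ edge< u t + edge< t u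
  𝟙adj≡edge<+edge< u t with <-cmp u t
  ... | tri< u<t _ t≮u rewrite dec-true (u <? t) u<t | dec-false (t <? u) t≮u =
    sym (+-identityʳ _)
  ... | tri> u≮t _ t<u rewrite dec-false (u <? t) u≮t | dec-true (t <? u) t<u =
    cong 𝟙 (adj-sym G u t)
  ... | tri≈ u≮u refl _ rewrite dec-false (u <? u) u≮u | irrefl G u = refl

  handshake : ∑∑ (λ u t → 𝟙 (adj G u t)) ≡ 2 * e G
  handshake = begin
    ∑∑ (λ u t → 𝟙 (adj G u t))           ≡⟨ sum-cong-≗ (λ u → sum-cong-≗ (𝟙adj≡edge<+edge< u)) ⟩
    ∑∑ (λ u t → edge< u t + edge< t u)   ≡⟨ ∑∑-symmetrise edge< ⟩
    2 * ∑∑ edge<                         ≡⟨ cong (2 *_) e≡∑∑edge< ⟨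
    2 * e G                              ∎
    where open ≡-Reasoning

  ∑∑-charge≤2e : (f : Fin n → Fin n → ℕ) →
    (∀ u t → f u t + f t u ≤ 2 * 𝟙 (adj G u t)) → ∑∑ f ≤ 2 * e G
  ∑∑-charge≤2e f f≤2·adj = begin
    ∑∑ f                         ≤⟨ ∑∑-mono-symmetrised f (λ u t → 𝟙 (adj G u t)) f≤adj+adj ⟩
    ∑∑ (λ u t → 𝟙 (adj G u t))   ≡⟨ handshake ⟩
    2 * e G                      ∎
    where
    open ≤-Reasoning
    f≤adj+adj : ∀ u t → f u t + f t u ≤ 𝟙 (adj G u t) + 𝟙 (adj G t u)
    f≤adj+adj u t rewrite adj-sym G t u =
      subst (f u t + f t u ≤_) (cong (𝟙 (adj G u t) +_) (+-identityʳ _)) (f≤2·adj u t)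

CommonNeighbour : ∀ {n} → (Fin n → Fin n → Bool) → Fin n → Fin n → Fin n → Set
CommonNeighbour A p q y = A p y ≡ true × A q y ≡ true

TwoCommonNeighbours : ∀ {n} → (Fin n → Fin n → Bool) → Fin n → Fin n → Set
TwoCommonNeighbours A p q =
  ∃₂ λ y z → y ≢ z × CommonNeighbour A p q y × CommonNeighbour A p q z

TwoCommonNeighbours-sym : ∀ {n} {A : Fin n → Fin n → Bool} {p q} →
  TwoCommonNeighbours A p q → TwoCommonNeighbours A q p
TwoCommonNeighbours-sym (y , z , y≢z , y∼pq , z∼pq) = y , z , y≢z , swap y∼pq , swap z∼pq

_∈⟨_,_⟩ : ∀ {n} → Fin n → Fin n → Fin n → Set
a ∈⟨ p , q ⟩ = a ≡ p ⊎ a ≡ q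

pair-pigeonhole : ∀ {n} {p q a b c : Fin n} →
  a ∈⟨ p , q ⟩ → b ∈⟨ p , q ⟩ → c ∈⟨ p , q ⟩ → a ≡ b ⊎ a ≡ c ⊎ b ≡ c
pair-pigeonhole (inj₁ refl) (inj₁ refl) _           = inj₁ refl
pair-pigeonhole (inj₂ refl) (inj₂ refl) _           = inj₁ refl
pair-pigeonhole (inj₁ refl) (inj₂ refl) (inj₁ refl) = inj₂ (inj₁ refl)
pair-pigeonhole (inj₁ refl) (inj₂ refl) (inj₂ refl) = inj₂ (inj₂ refl)
pair-pigeonhole (inj₂ refl) (inj₁ refl) (inj₁ refl) = inj₂ (inj₂ refl)
pair-pigeonhole (inj₂ refl) (inj₁ refl) (inj₂ refl) = inj₂ (inj₁ refl)

TwoCommonNeighbours-relabel : ∀ {n} {A : Fin n → Fin n → Bool} {p q a b} →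
  a ≢ b → a ∈⟨ p , q ⟩ → b ∈⟨ p , q ⟩ → TwoCommonNeighbours A a b → TwoCommonNeighbours A p q
TwoCommonNeighbours-relabel a≢b (inj₁ refl) (inj₁ refl) _ = ⊥-elim (a≢b refl)
TwoCommonNeighbours-relabel a≢b (inj₂ refl) (inj₂ refl) _ = ⊥-elim (a≢b refl)
TwoCommonNeighbours-relabel _   (inj₁ refl) (inj₂ refl) t = t
TwoCommonNeighbours-relabel {A = A} _ (inj₂ refl) (inj₁ refl) t = TwoCommonNeighbours-sym {A = A} t

-- A K₂,₃ of A′ must use x; as x has at most the two neighbours p and q, it sits in the part of size
-- three and {p, q} is the part of size two.
module _ {n} {A A′ : Fin n → Fin n → Bool} {x p q : Fin n}
  (A′⇒A : ∀ a c → a ≢ x → c ≢ x → A′ a c ≡ true → A a c ≡ true)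
  (from-x : ∀ c → A′ x c ≡ true → c ∈⟨ p , q ⟩)
  (into-x : ∀ a → A′ a x ≡ true → a ∈⟨ p , q ⟩)
  where

  module AtVertex (f : Fin 5 → Fin n) (inj : Injective _≡_ _≡_ f) (i : Fin 5) (fi≡x : f i ≡ x) where

    avoid : ∀ {j} → j ≢ i → f j ≢ x
    avoid j≢i fj≡x = j≢i (inj (trans fj≡x (sym fi≡x)))

    lift : ∀ {j k} → j ≢ i → k ≢ i → A′ (f j) (f k) ≡ true → A (f j) (f k) ≡ true
    lift j≢i k≢i = A′⇒A _ _ (avoid j≢i) (avoid k≢i)

    from : ∀ {j} → A′ (f i) (f j) ≡ true → f j ∈⟨ p , q ⟩
    from {j} e = from-x _ (subst (λ a → A′ a (f j) ≡ true) fi≡x e)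

    into : ∀ {j} → A′ (f j) (f i) ≡ true → f j ∈⟨ p , q ⟩
    into {j} e = into-x _ (subst (λ c → A′ (f j) c ≡ true) fi≡x e)

    no-three-in-pair : f two ∈⟨ p , q ⟩ → f three ∈⟨ p , q ⟩ → f four ∈⟨ p , q ⟩ → ⊥
    no-three-in-pair a b c with pair-pigeonhole a b c
    ... | inj₁ eq        with () ← inj eq
    ... | inj₂ (inj₁ eq) with () ← inj eq
    ... | inj₂ (inj₂ eq) with () ← inj eq

    in-part₃ : ∀ j k → j ≢ k → zero' ≢ i → one ≢ i → j ≢ i → k ≢ i →
      A′ (f zero') (f i) ≡ true → A′ (f one) (f i) ≡ true →
      A′ (f zero') (f j) ≡ true → A′ (f one) (f j) ≡ true →
      A′ (f zero') (f k) ≡ true → A′ (f one) (f k) ≡ true → TwoCommonNeighbours A p q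
    in-part₃ j k j≢k 0≢i 1≢i j≢i k≢i e0i e1i e0j e1j e0k e1k =
      TwoCommonNeighbours-relabel {A = A} (λ eq → zero'≢one (inj eq)) (into e0i) (into e1i)
        (f j , f k , (λ eq → j≢k (inj eq)) ,
         (lift 0≢i j≢i e0j , lift 1≢i j≢i e1j) , (lift 0≢i k≢i e0k , lift 1≢i k≢i e1k))
      where
      zero'≢one : zero' ≢ one
      zero'≢one ()

  K23-through-degree-two : ¬ ContainsK23 A → ContainsK23 A′ → TwoCommonNeighbours A p q
  K23-through-degree-two K23-free (f , inj , e02 , e03 , e04 , e12 , e13 , e14)
    with any? (λ i → f i ≟ x)
  ... | no x∉f = ⊥-elim (K23-free (f , inj ,
          lift e02 , lift e03 , lift e04 , lift e12 , lift e13 , lift e14))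
    where
    lift : ∀ {i j} → A′ (f i) (f j) ≡ true → A (f i) (f j) ≡ true
    lift {i} {j} = A′⇒A _ _ (λ fi≡x → x∉f (i , fi≡x)) (λ fj≡x → x∉f (j , fj≡x))
  ... | yes (zero , fi≡x) = ⊥-elim (no-three-in-pair (from e02) (from e03) (from e04))
    where open AtVertex f inj zero fi≡x
  ... | yes (suc zero , fi≡x) = ⊥-elim (no-three-in-pair (from e12) (from e13) (from e14))
    where open AtVertex f inj one fi≡x
  ... | yes (suc (suc zero) , fi≡x) =
    in-part₃ three four (λ ()) (λ ()) (λ ()) (λ ()) (λ ()) e02 e12 e03 e13 e04 e14
    where open AtVertex f inj two fi≡x
  ... | yes (suc (suc (suc zero)) , fi≡x) =
    in-part₃ two four (λ ()) (λ ()) (λ ()) (λ ()) (λ ()) e03 e13 e02 e12 e04 e14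
    where open AtVertex f inj three fi≡x
  ... | yes (suc (suc (suc (suc zero))) , fi≡x) =
    in-part₃ two three (λ ()) (λ ()) (λ ()) (λ ()) (λ ()) e04 e14 e02 e12 e03 e13
    where open AtVertex f inj four fi≡x

addEdge-cases : ∀ {n} (G : Graph n) {v u a c} → addEdge G v u a c ≡ true →
  adj G a c ≡ true ⊎ (a ≡ v × c ≡ u) ⊎ (a ≡ u × c ≡ v)
addEdge-cases G {v} {u} {a} {c} e with adj G a c | a ≟ v | c ≟ u | a ≟ u | c ≟ v
... | true  | _       | _       | _       | _       = inj₁ refl
... | false | yes a≡v | yes c≡u | _       | _       = inj₂ (inj₁ (a≡v , c≡u))
... | false | _       | _       | yes a≡u | yes c≡v = inj₂ (inj₂ (a≡u , c≡v))
... | false | no _    | _       | no _    | _       with () ← e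
... | false | no _    | _       | yes _   | no _    with () ← e
... | false | yes _   | no _    | no _    | _       with () ← e
... | false | yes _   | no _    | yes _   | no _    with () ← e

pendant-saturation : ∀ {n} (G : Graph n) {v w u} → (∀ t → adj G v t ≡ true → t ≡ w) → u ≢ v →
  ¬ ContainsK23 (adj G) → ContainsK23 (addEdge G v u) → TwoCommonNeighbours (adj G) w u
pendant-saturation G {v} {w} {u} only-w u≢v = K23-through-degree-two A′⇒A from-v into-v
  where
  A′⇒A : ∀ a c → a ≢ v → c ≢ v → addEdge G v u a c ≡ true → adj G a c ≡ true
  A′⇒A a c a≢v c≢v e with addEdge-cases G e
  ... | inj₁ a∼c              = a∼c
  ... | inj₂ (inj₁ (a≡v , _)) = ⊥-elim (a≢v a≡v)
  ... | inj₂ (inj₂ (_ , c≡v)) = ⊥-elim (c≢v c≡v)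

  from-v : ∀ c → addEdge G v u v c ≡ true → c ∈⟨ w , u ⟩
  from-v c e with addEdge-cases G e
  ... | inj₁ v∼c              = inj₁ (only-w c v∼c)
  ... | inj₂ (inj₁ (_ , c≡u)) = inj₂ c≡u
  ... | inj₂ (inj₂ (v≡u , _)) = ⊥-elim (u≢v (sym v≡u))

  into-v : ∀ a → addEdge G v u a v ≡ true → a ∈⟨ w , u ⟩
  into-v a e with addEdge-cases G e
  ... | inj₁ a∼v              = inj₁ (only-w a (trans (adj-sym G v a) a∼v))
  ... | inj₂ (inj₁ (_ , v≡u)) = ⊥-elim (u≢v (sym v≡u))
  ... | inj₂ (inj₂ (a≡u , _)) = inj₂ a≡u

share : (u≡w t≡w u∈B t∈B : Bool) → ℕ
share true  _     _     _     = 0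
share false true  _     _     = 2
share false false u∈B  true  = if u∈B then 1 else 2
share false false _     false = 0

share-pair : ∀ a b c d → share a b c d + share b a d c ≤ 2
share-pair true  true  _     _     = z≤n
share-pair true  false _     _     = ≤-refl
share-pair false true  _     _     = ≤-refl
share-pair false false true  true  = ≤-refl
share-pair false false true  false = ≤-refl
share-pair false false false true  = ≤-refl
share-pair false false false false = z≤n

module PendantCharge {n} (G : Graph n) {v w : Fin n}
  (v∼w : adj G v w ≡ true) (only-w : ∀ t → adj G v t ≡ true → t ≡ w) where

  inB : Fin n → Bool
  inB t = does (t ≟ w) ∨ (adj G w t ∧ not (does (t ≟ v)))

  charge : Fin n → Fin n → ℕ
  charge u t = if adj G u t then share (does (u ≟ w)) (does (t ≟ w)) (inB u) (inB t) else 0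

  received : Fin n → ℕ
  received u = sum (charge u)

  charge-pair : ∀ u t → charge u t + charge t u ≤ 2 * 𝟙 (adj G u t)
  charge-pair u t rewrite adj-sym G t u with adj G u t
  ... | true  = share-pair (does (u ≟ w)) (does (t ≟ w)) (inB u) (inB t)
  ... | false = z≤n

  v≢w : v ≢ w
  v≢w = adj⇒≢ G v∼w

  charge-at : ∀ {u t a b c d} → adj G u t ≡ true →
    does (u ≟ w) ≡ a → does (t ≟ w) ≡ b → inB u ≡ c → inB t ≡ d → charge u t ≡ share a b c d
  charge-at u∼t refl refl refl refl rewrite u∼t = refl

  charge-to-w : ∀ {u} → u ≢ w → adj G u w ≡ true → charge u w ≡ 2
  charge-to-w {u} u≢w u∼w = charge-at u∼w (dec-false (u ≟ w) u≢w) (dec-true (w ≟ w) refl) refl refl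

  received-v : 2 ≤ received v
  received-v = subst (_≤ received v) (charge-to-w v≢w v∼w) (∑-pick₁ (charge v) w)

  module _ {u} (u≢v : u ≢ v) (u≢w : u ≢ w) where

    common-neighbour-in-B : ∀ {y} → CommonNeighbour (adj G) w u y → y ≢ w × inB y ≡ true
    common-neighbour-in-B {y} (w∼y , u∼y) = y≢w , y∈B
      where
      y≢w : y ≢ w
      y≢w = ≢-sym (adj⇒≢ G w∼y)
      y≢v : y ≢ v
      y≢v refl = u≢w (only-w u (trans (adj-sym G v u) u∼y))
      y∈B : inB y ≡ true
      y∈B rewrite dec-false (y ≟ w) y≢w | dec-false (y ≟ v) y≢v | w∼y = refl

    inB-other : inB u ≡ adj G w u
    inB-other rewrite dec-false (u ≟ w) u≢w | dec-false (u ≟ v) u≢v = ∧-identityʳ (adj G w u)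

    charge-from-B : ∀ {b y} → adj G w u ≡ b → CommonNeighbour (adj G) w u y →
      charge u y ≡ (if b then 1 else 2)
    charge-from-B {y = y} w∼u y∼wu@(_ , u∼y) with common-neighbour-in-B y∼wu
    ... | y≢w , y∈B =
      charge-at u∼y (dec-false (u ≟ w) u≢w) (dec-false (y ≟ w) y≢w) (trans inB-other w∼u) y∈B

    received-other : TwoCommonNeighbours (adj G) w u → 4 ≤ received u
    received-other (y , z , y≢z , y∼wu , z∼wu) = by-adjacency (adj G w u) refl
      where
      open ≤-Reasoning
      w≢ : ∀ {t} → CommonNeighbour (adj G) w u t → w ≢ t
      w≢ t∼wu = ≢-sym (proj₁ (common-neighbour-in-B t∼wu))

      by-adjacency : ∀ b → adj G w u ≡ b → 4 ≤ received u
      by-adjacency true w∼u = begin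
        4                                        ≡⟨ cong₂ _+_ (charge-to-w u≢w (trans (adj-sym G u w) w∼u))
                                                      (cong₂ _+_ (charge-from-B w∼u y∼wu) (charge-from-B w∼u z∼wu)) ⟨
        charge u w + (charge u y + charge u z)   ≤⟨ ∑-pick₃ (charge u) (w≢ y∼wu) (w≢ z∼wu) y≢z ⟩
        received u                               ∎
      by-adjacency false w∼u = begin
        4                         ≡⟨ cong₂ _+_ (charge-from-B w∼u y∼wu) (charge-from-B w∼u z∼wu) ⟨
        charge u y + charge u z   ≤⟨ ∑-pick₂ (charge u) y≢z ⟩
        received u                ∎

2*[2*[2+m]∸3]≡2+m*4 : ∀ m → 2 * (2 * (2 + m) ∸ 3) ≡ 2 + m * 4
2*[2*[2+m]∸3]≡2+m*4 m = begin
  2 * (2 * (2 + m) ∸ 3)   ≡⟨ cong (λ k → 2 * (k ∸ 3)) (*-distribˡ-+ 2 2 m) ⟩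
  2 * (1 + 2 * m)         ≡⟨ ring m ⟩
  2 + m * 4               ∎
  where
  open ≡-Reasoning
  ring : ∀ m → 2 * (1 + 2 * m) ≡ 2 + m * 4
  ring = solve-∀

lemma4p1 : (n : ℕ) (G : Graph n) → SatK23Graph G → MinDegree G 1 → 2 * n ∸ 3 ≤ e G
lemma4p1 0 _ _ _ = z≤n
lemma4p1 1 _ _ _ = z≤n
lemma4p1 (suc (suc m)) G ((K23-free , saturated) , _) ((v , deg-v≡1) , _)
  with ∑-𝟙≡1⇒∃! (adj G v) (trans (sym (count≡∑𝟙 (adj G v))) deg-v≡1)
... | w , v∼w , only-w = *-cancelˡ-≤ 2 (begin
  2 * (2 * (2 + m) ∸ 3)   ≡⟨ 2*[2*[2+m]∸3]≡2+m*4 m ⟩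
  2 + 0 + m * 4           ≤⟨ ∑-except₂ received v≢w received-v z≤n received-others ⟩
  ∑∑ charge               ≤⟨ ∑∑-charge≤2e G charge charge-pair ⟩
  2 * e G                 ∎)
  where
  open PendantCharge G v∼w only-w
  open ≤-Reasoning
  received-others : ∀ u → u ≢ v → u ≢ w → 4 ≤ received u
  received-others u u≢v u≢w = received-other u≢v u≢w
    (pendant-saturation G only-w u≢v K23-free
      (saturated v u (≢-sym u≢v) (¬-not (u≢w ∘ only-w u))))
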